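{- Let $k,\ell\ge1$. There is a bijection between the set of partitions $\lambda\in P(k,\ell)$ in which every nonzero part has even multiplicity and parity opposite to $\ell$ and (when $\ell$ is odd) $0$ has even multiplicity, and the set of self-complementary partitions in $P(k,\ell)$.
   Context: $P(k,\ell)$ is the set of partitions $\lambda=(\lambda_1,\dots,\lambda_k)$ with $\ell\ge\lambda_1\ge\cdots\ge\lambda_k\ge0$ (exactly $k$ parts; zero parts are counted in multiplicities). The complement of $\lambda$ in the $k\times\ell$ rectangle is $(\ell-\lambda_k,\ell-\lambda_{k-1},\dots,\ell-\lambda_1)$; $\lambda$ is self-complementary if it equals its complement. (The partitions in the first set are precisely the critical cells of a Morse matching on $P(k,\ell)$ considered in the paper.) -}

module Defs where

open import Data.Nat using (ℕ; zero; suc; _≤_; _+_)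
open import Data.Nat.Properties using (_≟_)
open import Data.Nat.Divisibility using (_∣_)
open import Data.Fin using (Fin) renaming (_≤_ to _≤ᶠ_)
open import Data.Vec using (Vec; lookup; reverse; map; count)
open import Data.Product using (Σ; _×_)
open import Relation.Binary.PropositionalEquality using (_≡_; _≢_)
open import Relation.Nullary using (¬_)

Even : ℕ → Set
Even n = 2 ∣ n

Odd : ℕ → Set
Odd n = ¬ Even n

-- λ ∈ P(k, ℓ): a vector of exactly k parts, weakly decreasing, all parts ≤ ℓ
-- (zero parts allowed and counted).
InP : (k ℓ : ℕ) → Vec ℕ k → Set
InP k ℓ v = (∀ (i j : Fin k) → i ≤ᶠ j → lookup v j ≤ lookup v i)
          × (∀ (i : Fin k) → lookup v i ≤ ℓ)

mult : {k : ℕ} → Vec ℕ k → ℕ → ℕ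
mult v m = count (m ≟_) v

complement : {k : ℕ} → ℕ → Vec ℕ k → Vec ℕ k
complement ℓ v = reverse (map (Data.Nat._∸_ ℓ) v)

SelfComplementary : {k : ℕ} → ℕ → Vec ℕ k → Set
SelfComplementary ℓ v = complement ℓ v ≡ v

CondA : {k : ℕ} → ℕ → Vec ℕ k → Set
CondA {k} ℓ v =
  (∀ (i : Fin k) → lookup v i ≢ 0 →
      Even (mult v (lookup v i)) × Odd (lookup v i + ℓ))
  × (Odd ℓ → Even (mult v 0))

-- A bijection between the subsets {v | A v} and {v | B v} of a type X:
-- maps f, g restricting to A → B and B → A and mutually inverse there.
-- (Stated on underlying elements to avoid proof-relevance of the predicates.)
BijBetween : {X : Set} → (X → Set) → (X → Set) → Set
BijBetween {X} A B =
  Σ (X → X) λ f → Σ (X → X) λ g →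
      (∀ x → A x → B (f x))
    × (∀ y → B y → A (g y))
    × (∀ x → A x → g (f x) ≡ x)
    × (∀ y → B y → f (g y) ≡ y)

-- A partition satisfying the condition is a decreasing sequence of equal pairs x, x with x = 0
-- or x + ℓ odd, followed by one extra 0 when ℓ is even and k odd.  Send the first pair to the
-- two parts h = ⌈(x + ℓ)/2⌉ and ℓ − h at the two ends, and nest the image of the remaining
-- pairs in between.  The result is self-complementary by construction, and decreasing because
-- the parts coming from smaller pairs lie in the band [ℓ − h, h].  Conversely a
-- self-complementary partition is determined by its first half, and a ↦ 2a − ℓ − 1 inverts
-- x ↦ ⌈(x + ℓ)/2⌉ on the admissible parts.
module Submission where

open import Defs
open import Data.Nat using (ℕ; zero; suc; _+_; _∸_; _≤_; _<_; _≥_; z≤n; s≤s; ⌈_/2⌉; ⌊_/2⌋)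
open import Data.Nat.Properties
open import Data.Nat.Divisibility using (divides; _∣?_; ∣-refl; ∣m+n∣m⇒∣n; ∣m∣n⇒∣m+n; ∣1⇒≡1)
open import Data.Vec using (Vec; []; _∷_; _∷ʳ_; lookup; reverse; map; init; initLast)
open import Data.Vec.Properties using (reverse-∷; reverse-involutive; map-∷ʳ; init-∷ʳ; ∷-injective; ∷ʳ-injective)
open import Data.Vec.Relation.Unary.All as All using (All; []; _∷_)
open import Data.Vec.Relation.Unary.All.Properties using (lookup⁺; lookup⁻)
open import Data.Vec.Relation.Unary.AllPairs using (AllPairs; []; _∷_)
open import Data.Fin using (Fin) renaming (zero to fzero; suc to fsuc; _≤_ to _≤ᶠ_)
open import Data.Product as Product using (_×_; _,_; proj₁; proj₂; Σ)
open import Data.Sum as Sum using (_⊎_; inj₁; inj₂)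
open import Data.Unit using (tt)
open import Data.Empty using (⊥-elim)
open import Function using (_∘_; _⇔_; mk⇔; Equivalence)
open import Function.Construct.Identity using (⇔-id)
open import Relation.Nullary using (yes; no)
open import Relation.Nullary.Decidable using (dec-true; dec-false)
open import Relation.Binary.PropositionalEquality

private
  variable
    A : Set
    n : ℕ

even-double : ∀ t → Even (t + t)
even-double t = divides t (trans (cong (t +_) (sym (+-identityʳ t))) (*-comm 2 t))

odd-one : Odd 1
odd-one ev with ∣1⇒≡1 ev
... | ()

even-2+ : ∀ {m} → Even (2 + m) ⇔ Even m
even-2+ = mk⇔ (λ ev → ∣m+n∣m⇒∣n ev ∣-refl) (∣m∣n⇒∣m+n ∣-refl)

even⇒odd-suc : ∀ {m} → Even m → Odd (suc m)
even⇒odd-suc {m} ev ev′ = odd-one (∣m+n∣m⇒∣n (subst Even (+-comm 1 m) ev′) ev)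

⌈n/2⌉+⌈n/2⌉ : ∀ m → (Even m × ⌈ m /2⌉ + ⌈ m /2⌉ ≡ m) ⊎ (Odd m × ⌈ m /2⌉ + ⌈ m /2⌉ ≡ suc m)
⌈n/2⌉+⌈n/2⌉ zero          = inj₁ (even-double 0 , refl)
⌈n/2⌉+⌈n/2⌉ (suc zero)    = inj₂ (odd-one , refl)
⌈n/2⌉+⌈n/2⌉ (suc (suc m)) =
  Sum.map (Product.map (Equivalence.from even-2+) add-two)
          (Product.map (_∘ Equivalence.to even-2+) add-two)
          (⌈n/2⌉+⌈n/2⌉ m)
  where
  add-two : ∀ {c} → ⌈ m /2⌉ + ⌈ m /2⌉ ≡ c → suc ⌈ m /2⌉ + suc ⌈ m /2⌉ ≡ 2 + c
  add-two eq = cong suc (trans (+-suc ⌈ m /2⌉ ⌈ m /2⌉) (cong suc eq))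

reverse-∷ʳ : ∀ x (xs : Vec A n) → reverse (xs ∷ʳ x) ≡ x ∷ reverse xs
reverse-∷ʳ x xs = begin
  reverse (xs ∷ʳ x)                   ≡⟨ cong (λ ys → reverse (ys ∷ʳ x)) (reverse-involutive xs) ⟨
  reverse (reverse (reverse xs) ∷ʳ x) ≡⟨ cong reverse (reverse-∷ x (reverse xs)) ⟨
  reverse (reverse (x ∷ reverse xs))  ≡⟨ reverse-involutive (x ∷ reverse xs) ⟩
  x ∷ reverse xs                      ∎
  where open ≡-Reasoning

module _ {P : A → Set} where

  All-∷ʳ⁺ : ∀ {x} {xs : Vec A n} → All P xs → P x → All P (xs ∷ʳ x)
  All-∷ʳ⁺ []         px = px ∷ []
  All-∷ʳ⁺ (py ∷ pxs) px = py ∷ All-∷ʳ⁺ pxs px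

  All-∷ʳ⁻ : ∀ {x} (xs : Vec A n) → All P (xs ∷ʳ x) → All P xs × P x
  All-∷ʳ⁻ []       (px ∷ [])  = [] , px
  All-∷ʳ⁻ (_ ∷ xs) (py ∷ pxs) = Product.map₁ (py ∷_) (All-∷ʳ⁻ xs pxs)

module _ {R : A → A → Set} where

  AllPairs-∷ʳ⁺ : ∀ {x} {xs : Vec A n} → AllPairs R xs → All (λ y → R y x) xs → AllPairs R (xs ∷ʳ x)
  AllPairs-∷ʳ⁺ []         []         = [] ∷ []
  AllPairs-∷ʳ⁺ (ry ∷ rxs) (yx ∷ xsx) = All-∷ʳ⁺ ry yx ∷ AllPairs-∷ʳ⁺ rxs xsx

  AllPairs-∷ʳ⁻ : ∀ {x} (xs : Vec A n) → AllPairs R (xs ∷ʳ x) → AllPairs R xs × All (λ y → R y x) xs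
  AllPairs-∷ʳ⁻ []       _          = [] , []
  AllPairs-∷ʳ⁻ (_ ∷ xs) (ry ∷ rxs) =
    let ry′ , yx = All-∷ʳ⁻ xs ry ; rxs′ , xsx = AllPairs-∷ʳ⁻ xs rxs in (ry′ ∷ rxs′) , (yx ∷ xsx)

Decreasing : Vec ℕ n → Set
Decreasing = AllPairs _≥_

lookup-antitone⇒decreasing : (v : Vec ℕ n) → (∀ i j → i ≤ᶠ j → lookup v j ≤ lookup v i) → Decreasing v
lookup-antitone⇒decreasing []      _   = []
lookup-antitone⇒decreasing (x ∷ v) dec =
    lookup⁻ (λ i → dec fzero (fsuc i) z≤n)
  ∷ lookup-antitone⇒decreasing v (λ i j i≤j → dec (fsuc i) (fsuc j) (s≤s i≤j))

decreasing⇒lookup-antitone : ∀ {v : Vec ℕ n} → Decreasing v → ∀ i j → i ≤ᶠ j → lookup v j ≤ lookup v i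
decreasing⇒lookup-antitone (_ ∷ _)   fzero    fzero    _         = ≤-refl
decreasing⇒lookup-antitone (x≥v ∷ _) fzero    (fsuc j) _         = lookup⁺ x≥v j
decreasing⇒lookup-antitone (_ ∷ dec) (fsuc i) (fsuc j) (s≤s i≤j) = decreasing⇒lookup-antitone dec i j i≤j

mult-here : ∀ x (r : Vec ℕ n) → mult (x ∷ r) x ≡ suc (mult r x)
mult-here x r rewrite dec-true (x ≟ x) refl = refl

mult-there : ∀ {m x} (r : Vec ℕ n) → m ≢ x → mult (x ∷ r) m ≡ mult r m
mult-there {m = m} {x} r m≢x rewrite dec-false (m ≟ x) m≢x = refl

mult-absent : ∀ {m} (r : Vec ℕ n) → All (m ≢_) r → mult r m ≡ 0
mult-absent []      []           = refl
mult-absent (_ ∷ r) (m≢x ∷ m∉r) = trans (mult-there r m≢x) (mult-absent r m∉r)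

mult-strict-max : ∀ x (r : Vec ℕ n) → All (_< x) r → mult (x ∷ r) x ≡ 1
mult-strict-max x r r<x =
  trans (mult-here x r) (cong suc (mult-absent r (All.map (λ z<x x≡z → <-irrefl (sym x≡z) z<x) r<x)))

even-mult-pair : ∀ x m (r : Vec ℕ n) → Even (mult (x ∷ x ∷ r) m) ⇔ Even (mult r m)
even-mult-pair x m r with m ≟ x
... | yes refl rewrite mult-here m (m ∷ r) | mult-here m r = even-2+
... | no m≢x   rewrite mult-there (x ∷ r) m≢x | mult-there r m≢x = ⇔-id _

mult-occurs : ∀ (v : Vec ℕ n) m → mult v m ≡ 0 ⊎ Σ (Fin n) (λ i → lookup v i ≡ m)
mult-occurs []      m = inj₁ refl
mult-occurs (x ∷ v) m with m ≟ x
... | yes m≡x = inj₂ (fzero , sym m≡x)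
... | no m≢x  = Sum.map (trans (mult-there v m≢x)) (λ (i , vᵢ≡m) → fsuc i , vᵢ≡m) (mult-occurs v m)

module _ (ℓ : ℕ) where

  half : ℕ → ℕ
  half x = ⌈ x + ℓ /2⌉

  -- The inverse 2a − ℓ − 1 of half on admissible parts.  Truncated subtraction also
  -- gives unhalf a = 0 when 2a = ℓ, which inverts half 0 = ℓ/2 for even ℓ.
  unhalf : ℕ → ℕ
  unhalf a = a + a ∸ ℓ ∸ 1

  Admissible : ℕ → Set
  Admissible x = x ≡ 0 ⊎ Odd (x + ℓ)

  half-mono : ∀ {x y} → y ≤ x → half y ≤ half x
  half-mono y≤x = ⌈n/2⌉-mono (+-monoˡ-≤ ℓ y≤x)

  half-≤ : ∀ {x} → x ≤ ℓ → half x ≤ ℓ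
  half-≤ x≤ℓ = ≤-trans (half-mono x≤ℓ) (≤-reflexive (sym (n≡⌈n+n/2⌉ ℓ)))

  ℓ∸half≤half : ∀ x → ℓ ∸ half x ≤ half x
  ℓ∸half≤half x = m≤n+o⇒m∸n≤o ℓ (half x) (begin
    ℓ                 ≤⟨ m≤n+m ℓ x ⟩
    x + ℓ             ≡⟨ ⌊n/2⌋+⌈n/2⌉≡n (x + ℓ) ⟨
    ⌊ x + ℓ /2⌋ + half x ≤⟨ +-monoˡ-≤ (half x) (⌊n/2⌋≤⌈n/2⌉ (x + ℓ)) ⟩
    half x + half x   ∎)
    where open ≤-Reasoning

  unhalf-half : ∀ {x} → Admissible x → unhalf (half x) ≡ x
  unhalf-half {x} adm with ⌈n/2⌉+⌈n/2⌉ (x + ℓ)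
  ... | inj₂ (_ , eq) = cong (_∸ 1) (trans (cong (_∸ ℓ) eq) (m+n∸n≡m (suc x) ℓ))
  ... | inj₁ (ev , eq) with adm
  ...   | inj₁ refl = cong (_∸ 1) (trans (cong (_∸ ℓ) eq) (n∸n≡0 ℓ))
  ...   | inj₂ odd  = ⊥-elim (odd ev)

  half-unhalf : ∀ {a} → ℓ ≤ a + a → half (unhalf a) ≡ a
  half-unhalf {a} ℓ≤2a with a + a ∸ ℓ | m∸n+n≡m ℓ≤2a
  ... | zero  | ℓ≡2a  = trans (cong ⌈_/2⌉ ℓ≡2a) (sym (n≡⌈n+n/2⌉ a))
  ... | suc d | 1+d+ℓ≡2a = trans (cong ⌊_/2⌋ 1+d+ℓ≡2a) (sym (n≡⌊n+n/2⌋ a))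

  unhalf-odd : ∀ a → unhalf a ≢ 0 → Odd (unhalf a + ℓ)
  unhalf-odd a unhalf≢0 with a + a ∸ ℓ in eq
  ... | zero  = ⊥-elim (unhalf≢0 refl)
  ... | suc d = λ ev → even⇒odd-suc ev (subst Even 2a≡1+d+ℓ (even-double a))
    where
    ℓ≤2a : ℓ ≤ a + a
    ℓ≤2a = <⇒≤ (m∸n≢0⇒n<m (λ 2a∸ℓ≡0 → 0≢1+n (trans (sym 2a∸ℓ≡0) eq)))
    2a≡1+d+ℓ : a + a ≡ suc (d + ℓ)
    2a≡1+d+ℓ = trans (sym (m∸n+n≡m ℓ≤2a)) (cong (_+ ℓ) eq)

  unhalf-mono : ∀ {a b} → a ≤ b → unhalf a ≤ unhalf b
  unhalf-mono a≤b = ∸-monoˡ-≤ 1 (∸-monoˡ-≤ ℓ (+-mono-≤ a≤b a≤b))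

  unhalf-≤ : ∀ {a} → a ≤ ℓ → unhalf a ≤ ℓ
  unhalf-≤ {a} a≤ℓ = begin
    unhalf a  ≤⟨ m∸n≤m (a + a ∸ ℓ) 1 ⟩
    a + a ∸ ℓ ≤⟨ ∸-monoˡ-≤ ℓ (+-monoʳ-≤ a a≤ℓ) ⟩
    a + ℓ ∸ ℓ ≡⟨ m+n∸n≡m a ℓ ⟩
    a         ≤⟨ a≤ℓ ⟩
    ℓ         ∎
    where open ≤-Reasoning

  half-centre : Even ℓ → ℓ ∸ half 0 ≡ half 0
  half-centre ev with ⌈n/2⌉+⌈n/2⌉ ℓ
  ... | inj₁ (_ , eq)   = trans (cong (_∸ half 0) (sym eq)) (m+n∸n≡m (half 0) (half 0))
  ... | inj₂ (odd , _) = ⊥-elim (odd ev)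

  unhalf-centre : ∀ {y} → ℓ ≡ y + y → unhalf y ≡ 0
  unhalf-centre {y} ℓ≡2y = cong (_∸ 1) (trans (cong (y + y ∸_) ℓ≡2y) (n∸n≡0 (y + y)))

  InBand : ℕ → ℕ → Set
  InBand x w = ℓ ∸ half x ≤ w × w ≤ half x

  half-inBand : ∀ {x y} → y ≤ x → InBand x (half y)
  half-inBand y≤x = ≤-trans (∸-monoʳ-≤ ℓ (half-mono y≤x)) (ℓ∸half≤half _) , half-mono y≤x

  co-half-inBand : ∀ {x y} → y ≤ x → InBand x (ℓ ∸ half y)
  co-half-inBand y≤x = ∸-monoʳ-≤ ℓ (half-mono y≤x) , ≤-trans (ℓ∸half≤half _) (half-mono y≤x)

  InP⇒decreasing×bounded : (v : Vec ℕ n) → InP n ℓ v → Decreasing v × All (_≤ ℓ) v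
  InP⇒decreasing×bounded v (dec , bnd) = lookup-antitone⇒decreasing v dec , lookup⁻ bnd

  decreasing×bounded⇒InP : ∀ {v : Vec ℕ n} → Decreasing v → All (_≤ ℓ) v → InP n ℓ v
  decreasing×bounded⇒InP dec bnd = decreasing⇒lookup-antitone dec , lookup⁺ bnd

  complement-shell : ∀ a (m : Vec ℕ n) b →
                     complement ℓ (a ∷ (m ∷ʳ b)) ≡ (ℓ ∸ b) ∷ (complement ℓ m ∷ʳ (ℓ ∸ a))
  complement-shell a m b = begin
    reverse ((ℓ ∸ a) ∷ map (ℓ ∸_) (m ∷ʳ b))
      ≡⟨ reverse-∷ (ℓ ∸ a) (map (ℓ ∸_) (m ∷ʳ b)) ⟩
    reverse (map (ℓ ∸_) (m ∷ʳ b)) ∷ʳ (ℓ ∸ a)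
      ≡⟨ cong (λ w → reverse w ∷ʳ (ℓ ∸ a)) (map-∷ʳ (ℓ ∸_) b m) ⟩
    reverse (map (ℓ ∸_) m ∷ʳ (ℓ ∸ b)) ∷ʳ (ℓ ∸ a)
      ≡⟨ cong (_∷ʳ (ℓ ∸ a)) (reverse-∷ʳ (ℓ ∸ b) (map (ℓ ∸_) m)) ⟩
    (ℓ ∸ b) ∷ (complement ℓ m ∷ʳ (ℓ ∸ a))
      ∎
    where open ≡-Reasoning

  EvenMultiplicities : Vec ℕ n → Set
  EvenMultiplicities v = ∀ m → m ≢ 0 ⊎ Odd ℓ → Even (mult v m)

  OppositeParity : Vec ℕ n → Set
  OppositeParity = All (λ z → z ≢ 0 → Odd (z + ℓ))

  CondA⇒evenMultiplicities : ∀ {v : Vec ℕ n} → CondA ℓ v → EvenMultiplicities v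
  CondA⇒evenMultiplicities {v = v} (nonzero , zero-even) m m≢0⊎odd with mult-occurs v m | m≢0⊎odd
  ... | inj₁ mult≡0 | _ = subst Even (sym mult≡0) (even-double 0)
  ... | inj₂ (i , refl) | inj₁ vᵢ≢0 = proj₁ (nonzero i vᵢ≢0)
  ... | inj₂ (i , refl) | inj₂ odd with lookup v i ≟ 0
  ...   | yes vᵢ≡0 = subst (Even ∘ mult v) (sym vᵢ≡0) (zero-even odd)
  ...   | no vᵢ≢0  = proj₁ (nonzero i vᵢ≢0)

  CondA⇒oppositeParity : ∀ {v : Vec ℕ n} → CondA ℓ v → OppositeParity v
  CondA⇒oppositeParity (nonzero , _) = lookup⁻ (λ i vᵢ≢0 → proj₂ (nonzero i vᵢ≢0))

  ⇒CondA : ∀ {v : Vec ℕ n} → EvenMultiplicities v → OppositeParity v → CondA ℓ v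
  ⇒CondA {v = v} evm par =
    (λ i vᵢ≢0 → evm (lookup v i) (inj₁ vᵢ≢0) , lookup⁺ par i vᵢ≢0) , (λ odd → evm 0 (inj₂ odd))

  data Doubled : Vec ℕ n → Set where
    []     : Doubled []
    [0]    : Even ℓ → Doubled (0 ∷ [])
    pair   : ∀ {x} {r : Vec ℕ n} → Admissible x → x ≤ ℓ → All (x ≥_) r → Doubled r → Doubled (x ∷ x ∷ r)

  zeros-doubled : Even ℓ → (v : Vec ℕ n) → All (_≡ 0) v → Doubled v
  zeros-doubled ev []          []                  = []
  zeros-doubled ev (_ ∷ [])    (refl ∷ [])         = [0] ev
  zeros-doubled ev (_ ∷ _ ∷ v) (refl ∷ refl ∷ v≡0) =
    pair (inj₁ refl) z≤n (All.map (λ { refl → z≤n }) v≡0) (zeros-doubled ev v v≡0)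

  mutual
    doubled : ∀ {v : Vec ℕ n} → Decreasing v → All (_≤ ℓ) v →
              EvenMultiplicities v → OppositeParity v → Doubled v
    doubled [] _ _ _ = []
    doubled {v = x ∷ v} (x≥v ∷ dec) (x≤ℓ ∷ v≤ℓ) evm (px ∷ pv) with x ≟ 0 | 2 ∣? ℓ
    ... | yes refl | yes ev  = zeros-doubled ev (0 ∷ v) (refl ∷ All.map n≤0⇒n≡0 x≥v)
    ... | yes refl | no odd  = doubled-head (inj₂ odd) (inj₁ refl) x≤ℓ x≥v dec v≤ℓ evm pv
    ... | no x≢0  | _        = doubled-head (inj₁ x≢0) (inj₂ (px x≢0)) x≤ℓ x≥v dec v≤ℓ evm pv

    -- A head of even multiplicity is repeated: otherwise it is a strict maximum and occurs once.
    doubled-head : ∀ {x} {v : Vec ℕ n} → x ≢ 0 ⊎ Odd ℓ → Admissible x → x ≤ ℓ → All (x ≥_) v →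
                   Decreasing v → All (_≤ ℓ) v →
                   EvenMultiplicities (x ∷ v) → OppositeParity v → Doubled (x ∷ v)
    doubled-head {x = x} {[]} evm-applies _ _ _ _ _ evm _ =
      ⊥-elim (odd-one (subst Even (mult-strict-max x [] []) (evm x evm-applies)))
    doubled-head {x = x} {y ∷ r} evm-applies adm x≤ℓ (y≤x ∷ r≤x) (y≥r ∷ dec) (_ ∷ r≤ℓ) evm (_ ∷ pr)
      with y ≟ x
    ... | yes refl =
      pair adm x≤ℓ y≥r (doubled dec r≤ℓ (λ m c → Equivalence.to (even-mult-pair x m r) (evm m c)) pr)
    ... | no y≢x   = ⊥-elim (odd-one (subst Even (mult-strict-max x (y ∷ r) (y<x ∷ r<x)) (evm x evm-applies)))
      where
      y<x = ≤∧≢⇒< y≤x y≢x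
      r<x = All.map (λ z≤y → ≤-<-trans z≤y y<x) y≥r

  data Nested : Vec ℕ n → Set where
    []     : Nested []
    centre : ∀ {y} → ℓ ≡ y + y → Nested (y ∷ [])
    shell  : ∀ {a} {m : Vec ℕ n} → ℓ ≤ a + a → All (a ≥_) m → Nested m → Nested (a ∷ (m ∷ʳ (ℓ ∸ a)))

  nested : ∀ {v : Vec ℕ n} → Decreasing v → All (_≤ ℓ) v → SelfComplementary ℓ v → Nested v
  nested {v = []} _ _ _ = []
  nested {v = y ∷ []} _ (y≤ℓ ∷ []) sc =
    centre (trans (sym (m∸n+n≡m y≤ℓ)) (cong (_+ y) (proj₁ (∷-injective sc))))
  nested {n = suc (suc n)} {a ∷ w} (a≥w ∷ dec) (_ ∷ w≤ℓ) sc with initLast w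
  ... | m , c , refl
    with sc-m , refl ← ∷ʳ-injective (complement ℓ m) m
                         (proj₂ (∷-injective (trans (sym (complement-shell a m c)) sc)))
       | a≥m , ℓ∸a≤a ← All-∷ʳ⁻ m a≥w
    = shell (≤-trans (m≤n+m∸n ℓ a) (+-monoʳ-≤ a ℓ∸a≤a)) a≥m
            (nested (proj₁ (AllPairs-∷ʳ⁻ m dec)) (proj₁ (All-∷ʳ⁻ m w≤ℓ)) sc-m)

  toSC : Vec ℕ n → Vec ℕ n
  toSC []          = []
  toSC (x ∷ [])    = half x ∷ []
  toSC (x ∷ _ ∷ r) = half x ∷ (toSC r ∷ʳ (ℓ ∸ half x))

  fromSC : Vec ℕ n → Vec ℕ n
  fromSC {zero}        []       = []
  fromSC {suc zero}    (y ∷ []) = unhalf y ∷ []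
  fromSC {suc (suc n)} (a ∷ w)  = unhalf a ∷ unhalf a ∷ fromSC (init w)

  fromSC-shell : ∀ a (m : Vec ℕ n) b → fromSC (a ∷ (m ∷ʳ b)) ≡ unhalf a ∷ unhalf a ∷ fromSC m
  fromSC-shell a m b = cong (λ w → unhalf a ∷ unhalf a ∷ fromSC w) (init-∷ʳ b m)

  toSC-inBand : ∀ {x} {r : Vec ℕ n} → All (x ≥_) r → All (InBand x) (toSC r)
  toSC-inBand []              = []
  toSC-inBand (y≤x ∷ [])      = half-inBand y≤x ∷ []
  toSC-inBand (y≤x ∷ _ ∷ r≤x) = half-inBand y≤x ∷ All-∷ʳ⁺ (toSC-inBand r≤x) (co-half-inBand y≤x)

  toSC-decreasing : ∀ {v : Vec ℕ n} → Doubled v → Decreasing (toSC v)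
  toSC-decreasing []      = []
  toSC-decreasing ([0] _) = [] ∷ []
  toSC-decreasing (pair {x = x} _ _ r≤x d) =
      All-∷ʳ⁺ (All.map proj₂ band) (ℓ∸half≤half x)
    ∷ AllPairs-∷ʳ⁺ (toSC-decreasing d) (All.map proj₁ band)
    where band = toSC-inBand r≤x

  toSC-bounded : ∀ {v : Vec ℕ n} → Doubled v → All (_≤ ℓ) (toSC v)
  toSC-bounded []      = []
  toSC-bounded ([0] _) = half-≤ z≤n ∷ []
  toSC-bounded (pair {x = x} _ x≤ℓ _ d) = half-≤ x≤ℓ ∷ All-∷ʳ⁺ (toSC-bounded d) (m∸n≤m ℓ (half x))

  toSC-selfComplementary : ∀ {v : Vec ℕ n} → Doubled v → SelfComplementary ℓ (toSC v)
  toSC-selfComplementary []       = refl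
  toSC-selfComplementary ([0] ev) = cong (_∷ []) (half-centre ev)
  toSC-selfComplementary (pair {x = x} {r} _ x≤ℓ _ d) = begin
    complement ℓ (half x ∷ (toSC r ∷ʳ (ℓ ∸ half x)))
      ≡⟨ complement-shell (half x) (toSC r) _ ⟩
    (ℓ ∸ (ℓ ∸ half x)) ∷ (complement ℓ (toSC r) ∷ʳ (ℓ ∸ half x))
      ≡⟨ cong₂ (λ a w → a ∷ (w ∷ʳ (ℓ ∸ half x)))
               (m∸[m∸n]≡n (half-≤ x≤ℓ)) (toSC-selfComplementary d) ⟩
    half x ∷ (toSC r ∷ʳ (ℓ ∸ half x))
      ∎
    where open ≡-Reasoning

  fromSC-toSC : ∀ {v : Vec ℕ n} → Doubled v → fromSC (toSC v) ≡ v
  fromSC-toSC []      = refl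
  fromSC-toSC ([0] _) = cong (_∷ []) (unhalf-half (inj₁ refl))
  fromSC-toSC (pair {x = x} {r} adm _ _ d) = begin
    fromSC (half x ∷ (toSC r ∷ʳ (ℓ ∸ half x)))
      ≡⟨ fromSC-shell (half x) (toSC r) _ ⟩
    unhalf (half x) ∷ unhalf (half x) ∷ fromSC (toSC r)
      ≡⟨ cong₂ (λ y w → y ∷ y ∷ w) (unhalf-half adm) (fromSC-toSC d) ⟩
    x ∷ x ∷ r
      ∎
    where open ≡-Reasoning

  toSC-fromSC : ∀ {v : Vec ℕ n} → Nested v → toSC (fromSC v) ≡ v
  toSC-fromSC []            = refl
  toSC-fromSC (centre ℓ≡2y) = cong (_∷ []) (half-unhalf (≤-reflexive ℓ≡2y))
  toSC-fromSC (shell {a = a} {m} ℓ≤2a _ nm) = begin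
    toSC (fromSC (a ∷ (m ∷ʳ (ℓ ∸ a))))
      ≡⟨ cong toSC (fromSC-shell a m _) ⟩
    half (unhalf a) ∷ (toSC (fromSC m) ∷ʳ (ℓ ∸ half (unhalf a)))
      ≡⟨ cong₂ (λ b w → b ∷ (w ∷ʳ (ℓ ∸ b))) (half-unhalf ℓ≤2a) (toSC-fromSC nm) ⟩
    a ∷ (m ∷ʳ (ℓ ∸ a))
      ∎
    where open ≡-Reasoning

  fromSC-All : ∀ {P Q : ℕ → Set} → (∀ {a} → P a → Q (unhalf a)) →
               ∀ {v : Vec ℕ n} → Nested v → All P v → All Q (fromSC v)
  fromSC-All f []         []         = []
  fromSC-All f (centre _) (py ∷ [])  = f py ∷ []
  fromSC-All {Q = Q} f (shell {a = a} {m} _ _ nm) (pa ∷ pw) =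
    subst (All Q) (sym (fromSC-shell a m _)) (f pa ∷ f pa ∷ fromSC-All f nm (proj₁ (All-∷ʳ⁻ m pw)))

  fromSC-decreasing : ∀ {v : Vec ℕ n} → Nested v → Decreasing (fromSC v)
  fromSC-decreasing []         = []
  fromSC-decreasing (centre _) = [] ∷ []
  fromSC-decreasing (shell {a = a} {m} _ a≥m nm) =
    subst Decreasing (sym (fromSC-shell a m _)) ((≤-refl ∷ below) ∷ below ∷ fromSC-decreasing nm)
    where below = fromSC-All unhalf-mono nm a≥m

  fromSC-evenMultiplicities : ∀ {v : Vec ℕ n} → Nested v → EvenMultiplicities (fromSC v)
  fromSC-evenMultiplicities [] _ _ = even-double 0
  fromSC-evenMultiplicities (centre {y} ℓ≡2y) m (inj₁ m≢0) =
    subst Even (sym (mult-there [] m≢unhalf)) (even-double 0)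
    where m≢unhalf = λ m≡unhalf → m≢0 (trans m≡unhalf (unhalf-centre {y} ℓ≡2y))
  fromSC-evenMultiplicities (centre {y} ℓ≡2y) m (inj₂ odd) =
    ⊥-elim (odd (subst Even (sym ℓ≡2y) (even-double y)))
  fromSC-evenMultiplicities (shell {a = a} {m′} _ _ nm) m c =
    subst (λ w → Even (mult w m)) (sym (fromSC-shell a m′ _))
          (Equivalence.from (even-mult-pair (unhalf a) m (fromSC m′)) (fromSC-evenMultiplicities nm m c))

  fromSC-bounded : ∀ {v : Vec ℕ n} → Nested v → All (_≤ ℓ) v → All (_≤ ℓ) (fromSC v)
  fromSC-bounded = fromSC-All {P = _≤ ℓ} unhalf-≤

  fromSC-oppositeParity : ∀ {v : Vec ℕ n} → Nested v → OppositeParity (fromSC v)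
  fromSC-oppositeParity nv = fromSC-All (λ {a} _ → unhalf-odd a) nv (All.universal (λ _ → tt) _)

  InP×CondA⇒doubled : (v : Vec ℕ n) → InP n ℓ v × CondA ℓ v → Doubled v
  InP×CondA⇒doubled v (inP , cond) =
    let dec , bnd = InP⇒decreasing×bounded v inP
    in doubled dec bnd (CondA⇒evenMultiplicities {v = v} cond) (CondA⇒oppositeParity {v = v} cond)

  InP×SelfComplementary⇒nested : (v : Vec ℕ n) → InP n ℓ v × SelfComplementary ℓ v → Nested v
  InP×SelfComplementary⇒nested v (inP , sc) = let dec , bnd = InP⇒decreasing×bounded v inP in nested dec bnd sc

theorem4p5 : (k ℓ : ℕ) → k ≥ 1 → ℓ ≥ 1 →
    BijBetween {Vec ℕ k} (λ v → InP k ℓ v × CondA ℓ v)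
                         (λ v → InP k ℓ v × SelfComplementary ℓ v)
theorem4p5 k ℓ _ _ =
    toSC ℓ , fromSC ℓ , A⇒B , B⇒A
  , (λ v → fromSC-toSC ℓ ∘ InP×CondA⇒doubled ℓ v)
  , (λ v → toSC-fromSC ℓ ∘ InP×SelfComplementary⇒nested ℓ v)
  where
  A⇒B : ∀ v → InP k ℓ v × CondA ℓ v → InP k ℓ (toSC ℓ v) × SelfComplementary ℓ (toSC ℓ v)
  A⇒B v a = decreasing×bounded⇒InP ℓ (toSC-decreasing ℓ d) (toSC-bounded ℓ d) , toSC-selfComplementary ℓ d
    where d = InP×CondA⇒doubled ℓ v a

  B⇒A : ∀ v → InP k ℓ v × SelfComplementary ℓ v → InP k ℓ (fromSC ℓ v) × CondA ℓ (fromSC ℓ v)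
  B⇒A v b@((_ , bnd) , _) =
      decreasing×bounded⇒InP ℓ (fromSC-decreasing ℓ nv) (fromSC-bounded ℓ nv (lookup⁻ bnd))
    , ⇒CondA ℓ (fromSC-evenMultiplicities ℓ nv) (fromSC-oppositeParity ℓ nv)
    where nv = InP×SelfComplementary⇒nested ℓ v b
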